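{- For all terms $M, M'$: if $M\Rightarrow M'$, then $M\Rrightarrow M'$.
   Context: Terms and values of the call-by-value $\lambda$-calculus are defined by mutual induction from a countably infinite set of variables: values $V ::= x \mid \lambda x.M$ and terms $M,N,L ::= V \mid MN$, up to $\alpha$-conversion, application associating to the left; $\mathrm{fv}(M)$ is the set of free variables and $M\{V/x\}$ capture-avoiding substitution of a value. $^*$ denotes reflexive-transitive closure. In all rules below $m\ge0$ and $V,V'$ range over values. Head $\beta_v$-reduction $\to_{h\beta_v}$: least relation with $(\lambda x.M)V M_1\dots M_m \to_{h\beta_v} M\{V/x\}M_1\dots M_m$, and if $N\to_{h\beta_v}N'$ then $VNM_1\dots M_m\to_{h\beta_v}VN'M_1\dots M_m$. Head $\sigma$-reduction $\to_{h\sigma}$: least relation with $(\lambda x.M)NLM_1\dots M_m\to_{h\sigma}(\lambda x.ML)NM_1\dots M_m$ ($x\notin\mathrm{fv}(L)$), $V((\lambda x.L)N)M_1\dots M_m\to_{h\sigma}(\lambda x.VL)NM_1\dots M_m$ ($x\notin\mathrm{fv}(V)$), and if $N\to_{h\sigma}N'$ then $VNM_1\dots M_m\to_{h\sigma}VN'M_1\dots M_m$. Parallel reduction $\Rightarrow$ is the least relation closed under: ($\beta_v$) if $V\Rightarrow V'$ and $M_i\Rightarrow M_i'$ for $0\le i\le m$ then $(\lambda x.M_0)VM_1\dots M_m\Rightarrow M_0'\{V'/x\}M_1'\dots M_m'$; ($\sigma_1$) if $N\Rightarrow N'$, $L\Rightarrow L'$, $M_i\Rightarrow M_i'$ for $0\le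 i\le m$, and $x\notin\mathrm{fv}(L)$, then $(\lambda x.M_0)NLM_1\dots M_m\Rightarrow(\lambda x.M_0'L')N'M_1'\dots M_m'$; ($\sigma_3$) if $V\Rightarrow V'$, $N\Rightarrow N'$, $L\Rightarrow L'$, $M_i\Rightarrow M_i'$ for $1\le i\le m$, and $x\notin\mathrm{fv}(V)$, then $V((\lambda x.L)N)M_1\dots M_m\Rightarrow(\lambda x.V'L')N'M_1'\dots M_m'$; ($\lambda$) if $M_i\Rightarrow M_i'$ for $0\le i\le m$ then $(\lambda x.M_0)M_1\dots M_m\Rightarrow(\lambda x.M_0')M_1'\dots M_m'$; (var) if $M_i\Rightarrow M_i'$ for $1\le i\le m$ then $xM_1\dots M_m\Rightarrow xM_1'\dots M_m'$. Internal parallel reduction $\Rightarrow_{int}$ is the least relation with: if $N\Rightarrow N'$ then $\lambda x.N\Rightarrow_{int}\lambda x.N'$; $x\Rightarrow_{int}x$; if $V\Rightarrow V'$, $N\Rightarrow_{int}N'$ and $M_i\Rightarrow M_i'$ for $1\le i\le m$, then $VNM_1\dots M_m\Rightarrow_{int}V'N'M_1'\dots M_m'$. Strong parallel reduction: $M\Rrightarrow N$ iff $M\Rightarrow N$ and there exist terms $M',M''$ with $M\to_{h\beta_v}^*M'\to_{h\sigma}^*M''\Rightarrow_{int}N$. -}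

module Defs where

open import Data.Nat using (ℕ; zero; suc)
open import Data.List using (List; []; _∷_; foldl)
open import Data.List.Relation.Binary.Pointwise using (Pointwise)
open import Data.Product using (Σ; _×_; ∃₂)
open import Relation.Binary.Construct.Closure.ReflexiveTransitive using (Star)

-- Terms of the call-by-value λ-calculus, with de Bruijn indices
-- (so terms are identified up to α-conversion by construction).
data Term : Set where
  var : ℕ → Term
  lam : Term → Term
  app : Term → Term → Term

data IsValue : Term → Set where
  var : ∀ n → IsValue (var n)
  lam : ∀ M → IsValue (lam M)

apps : Term → List Term → Term
apps = foldl app

ext : (ℕ → ℕ) → ℕ → ℕ
ext ρ zero    = zero
ext ρ (suc n) = suc (ρ n)

rename : (ℕ → ℕ) → Term → Term
rename ρ (var n)   = var (ρ n)
rename ρ (lam M)   = lam (rename (ext ρ) M)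
rename ρ (app M N) = app (rename ρ M) (rename ρ N)

-- Weakening: a term placed under one extra binder, whose fresh variable
-- (index 0) therefore does not occur free in it.
shift : Term → Term
shift = rename suc

exts : (ℕ → Term) → ℕ → Term
exts σ zero    = var zero
exts σ (suc n) = shift (σ n)

subst : (ℕ → Term) → Term → Term
subst σ (var n)   = σ n
subst σ (lam M)   = lam (subst (exts σ) M)
subst σ (app M N) = app (subst σ M) (subst σ N)

-- M [ V ] : the body M of λx.M with V substituted for the bound variable x
single : Term → ℕ → Term
single V zero    = V
single V (suc n) = var n

_[_] : Term → Term → Term
M [ V ] = subst (single V) M

data _→hβv_ : Term → Term → Set where
  β    : ∀ {M V} Ms → IsValue V →
         apps (app (lam M) V) Ms →hβv apps (M [ V ]) Ms
  cong : ∀ {V N N'} Ms → IsValue V → N →hβv N' →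
         apps (app V N) Ms →hβv apps (app V N') Ms

-- Head σ-reduction (side conditions x ∉ fv(·) are realised by `shift`)
data _→hσ_ : Term → Term → Set where
  σ₁   : ∀ {M N L} Ms →
         apps (app (app (lam M) N) L) Ms →hσ apps (app (lam (app M (shift L))) N) Ms
  σ₃   : ∀ {V L N} Ms → IsValue V →
         apps (app V (app (lam L) N)) Ms →hσ apps (app (lam (app (shift V) L)) N) Ms
  cong : ∀ {V N N'} Ms → IsValue V → N →hσ N' →
         apps (app V N) Ms →hσ apps (app V N') Ms

data _⇒_ : Term → Term → Set where
  β   : ∀ {M₀ M₀' V V' Ms Ms'} → IsValue V → IsValue V' →
        V ⇒ V' → M₀ ⇒ M₀' → Pointwise _⇒_ Ms Ms' →
        apps (app (lam M₀) V) Ms ⇒ apps (M₀' [ V' ]) Ms'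
  σ₁  : ∀ {M₀ M₀' N N' L L' Ms Ms'} →
        N ⇒ N' → L ⇒ L' → M₀ ⇒ M₀' → Pointwise _⇒_ Ms Ms' →
        apps (app (app (lam M₀) N) L) Ms ⇒ apps (app (lam (app M₀' (shift L'))) N') Ms'
  σ₃  : ∀ {V V' N N' L L' Ms Ms'} → IsValue V → IsValue V' →
        V ⇒ V' → N ⇒ N' → L ⇒ L' → Pointwise _⇒_ Ms Ms' →
        apps (app V (app (lam L) N)) Ms ⇒ apps (app (lam (app (shift V') L')) N') Ms'
  lam : ∀ {M₀ M₀' Ms Ms'} → M₀ ⇒ M₀' → Pointwise _⇒_ Ms Ms' →
        apps (lam M₀) Ms ⇒ apps (lam M₀') Ms'
  var : ∀ {x Ms Ms'} → Pointwise _⇒_ Ms Ms' →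
        apps (var x) Ms ⇒ apps (var x) Ms'

data _⇒int_ : Term → Term → Set where
  lam : ∀ {N N'} → N ⇒ N' → lam N ⇒int lam N'
  var : ∀ x → var x ⇒int var x
  app : ∀ {V V' N N' Ms Ms'} → IsValue V → IsValue V' →
        V ⇒ V' → N ⇒int N' → Pointwise _⇒_ Ms Ms' →
        apps (app V N) Ms ⇒int apps (app V' N') Ms'

_⇛_ : Term → Term → Set
M ⇛ N = (M ⇒ N) × ∃₂ λ M' M'' →
          Star _→hβv_ M M' × Star _→hσ_ M' M'' × (M'' ⇒int N)

module Submission where

-- A β_v-redex fires as a head
-- step, after which the factorisation of its body is transported along the
-- substitution; a σ-redex fires after the head steps of its argument N
-- have been performed inside the redex; a value applied to a spine reduces
-- the head of its first argument and is otherwise internal.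

open import Defs
open import Data.Nat using (ℕ; zero; suc)
open import Data.Unit using (⊤; tt)
open import Data.Empty using (⊥; ⊥-elim)
open import Data.List using ([]; _∷_; map; _++_)
open import Data.List.Properties using (foldl-++)
open import Data.List.Relation.Binary.Pointwise using (Pointwise; []; _∷_)
  renaming (++⁺ to Pointwise-++⁺)
open import Data.Product using (_×_; ∃₂; _,_)
open import Function using (_∘_)
open import Relation.Binary.Construct.Closure.ReflexiveTransitive
  using (Star; ε; _◅_; _◅◅_; gmap)
open import Relation.Binary.PropositionalEquality
  using (_≡_; refl; sym; trans; module ≡-Reasoning)
  renaming (cong to ≡-cong; cong₂ to ≡-cong₂)

-- Rewrite both sides of any relation on terms along equations; used to
-- match the spine-shaped indices of the reduction relations.
retype : ∀ (R : Term → Term → Set) {A A' B B'} →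
         A ≡ A' → B ≡ B' → R A' B' → R A B
retype R refl refl r = r

ext-cong : ∀ {ρ ρ'} → (∀ n → ρ n ≡ ρ' n) → ∀ n → ext ρ n ≡ ext ρ' n
ext-cong h zero    = refl
ext-cong h (suc n) = ≡-cong suc (h n)

rename-cong : ∀ {ρ ρ'} → (∀ n → ρ n ≡ ρ' n) → ∀ M → rename ρ M ≡ rename ρ' M
rename-cong h (var n)   = ≡-cong var (h n)
rename-cong h (lam M)   = ≡-cong lam (rename-cong (ext-cong h) M)
rename-cong h (app M N) = ≡-cong₂ app (rename-cong h M) (rename-cong h N)

exts-cong : ∀ {σ τ} → (∀ n → σ n ≡ τ n) → ∀ n → exts σ n ≡ exts τ n
exts-cong h zero    = refl
exts-cong h (suc n) = ≡-cong shift (h n)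

subst-cong : ∀ {σ τ} → (∀ n → σ n ≡ τ n) → ∀ M → subst σ M ≡ subst τ M
subst-cong h (var n)   = h n
subst-cong h (lam M)   = ≡-cong lam (subst-cong (exts-cong h) M)
subst-cong h (app M N) = ≡-cong₂ app (subst-cong h M) (subst-cong h N)

rename-rename : ∀ ρ ρ' M → rename ρ (rename ρ' M) ≡ rename (ρ ∘ ρ') M
rename-rename ρ ρ' (var n)   = refl
rename-rename ρ ρ' (lam M)   =
  ≡-cong lam (trans (rename-rename (ext ρ) (ext ρ') M) (rename-cong ext-∘ M))
  where
  ext-∘ : ∀ n → ext ρ (ext ρ' n) ≡ ext (ρ ∘ ρ') n
  ext-∘ zero    = refl
  ext-∘ (suc n) = refl
rename-rename ρ ρ' (app M N) = ≡-cong₂ app (rename-rename ρ ρ' M) (rename-rename ρ ρ' N)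

subst-rename : ∀ σ ρ M → subst σ (rename ρ M) ≡ subst (σ ∘ ρ) M
subst-rename σ ρ (var n)   = refl
subst-rename σ ρ (lam M)   =
  ≡-cong lam (trans (subst-rename (exts σ) (ext ρ) M) (subst-cong exts-∘ M))
  where
  exts-∘ : ∀ n → exts σ (ext ρ n) ≡ exts (σ ∘ ρ) n
  exts-∘ zero    = refl
  exts-∘ (suc n) = refl
subst-rename σ ρ (app M N) = ≡-cong₂ app (subst-rename σ ρ M) (subst-rename σ ρ N)

rename-subst : ∀ ρ σ M → rename ρ (subst σ M) ≡ subst (rename ρ ∘ σ) M
rename-subst ρ σ (var n)   = refl
rename-subst ρ σ (lam M)   =
  ≡-cong lam (trans (rename-subst (ext ρ) (exts σ) M) (subst-cong exts-∘ M))
  where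
  exts-∘ : ∀ n → rename (ext ρ) (exts σ n) ≡ exts (rename ρ ∘ σ) n
  exts-∘ zero    = refl
  exts-∘ (suc n) = trans (rename-rename (ext ρ) suc (σ n)) (sym (rename-rename suc ρ (σ n)))
rename-subst ρ σ (app M N) = ≡-cong₂ app (rename-subst ρ σ M) (rename-subst ρ σ N)

subst-subst : ∀ σ τ M → subst σ (subst τ M) ≡ subst (subst σ ∘ τ) M
subst-subst σ τ (var n)   = refl
subst-subst σ τ (lam M)   =
  ≡-cong lam (trans (subst-subst (exts σ) (exts τ) M) (subst-cong exts-∘ M))
  where
  exts-∘ : ∀ n → subst (exts σ) (exts τ n) ≡ exts (subst σ ∘ τ) n
  exts-∘ zero    = refl
  exts-∘ (suc n) = trans (subst-rename (exts σ) suc (τ n)) (sym (rename-subst suc σ (τ n)))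
subst-subst σ τ (app M N) = ≡-cong₂ app (subst-subst σ τ M) (subst-subst σ τ N)

subst-id : ∀ M → subst var M ≡ M
subst-id (var n)   = refl
subst-id (lam M)   = ≡-cong lam (trans (subst-cong exts-var M) (subst-id M))
  where
  exts-var : ∀ n → exts var n ≡ var n
  exts-var zero    = refl
  exts-var (suc n) = refl
subst-id (app M N) = ≡-cong₂ app (subst-id M) (subst-id N)

subst-[] : ∀ σ M V → subst σ (M [ V ]) ≡ (subst (exts σ) M) [ subst σ V ]
subst-[] σ M V = begin
  subst σ (M [ V ])                                   ≡⟨ subst-subst σ (single V) M ⟩
  subst (subst σ ∘ single V) M                        ≡⟨ subst-cong single-exts M ⟨
  subst (subst (single (subst σ V)) ∘ exts σ) M       ≡⟨ subst-subst _ (exts σ) M ⟨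
  (subst (exts σ) M) [ subst σ V ]                    ∎
  where
  open ≡-Reasoning
  single-exts : ∀ n → subst (single (subst σ V)) (exts σ n) ≡ subst σ (single V n)
  single-exts zero    = refl
  single-exts (suc n) = trans (subst-rename (single (subst σ V)) suc (σ n)) (subst-id (σ n))

rename-[] : ∀ ρ M V → rename ρ (M [ V ]) ≡ (rename (ext ρ) M) [ rename ρ V ]
rename-[] ρ M V = begin
  rename ρ (M [ V ])                                  ≡⟨ rename-subst ρ (single V) M ⟩
  subst (rename ρ ∘ single V) M                       ≡⟨ subst-cong single-ext M ⟨
  subst (single (rename ρ V) ∘ ext ρ) M               ≡⟨ subst-rename _ (ext ρ) M ⟨
  (rename (ext ρ) M) [ rename ρ V ]                   ∎
  where
  open ≡-Reasoning
  single-ext : ∀ n → single (rename ρ V) (ext ρ n) ≡ rename ρ (single V n)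
  single-ext zero    = refl
  single-ext (suc n) = refl

subst-shift : ∀ σ L → subst (exts σ) (shift L) ≡ shift (subst σ L)
subst-shift σ L = trans (subst-rename (exts σ) suc L) (sym (rename-subst suc σ L))

rename-shift : ∀ ρ L → rename (ext ρ) (shift L) ≡ shift (rename ρ L)
rename-shift ρ L = trans (rename-rename (ext ρ) suc L) (sym (rename-rename suc ρ L))

subst-apps : ∀ σ M Ms → subst σ (apps M Ms) ≡ apps (subst σ M) (map (subst σ) Ms)
subst-apps σ M []       = refl
subst-apps σ M (N ∷ Ns) = subst-apps σ (app M N) Ns

rename-apps : ∀ ρ M Ms → rename ρ (apps M Ms) ≡ apps (rename ρ M) (map (rename ρ) Ms)
rename-apps ρ M []       = refl
rename-apps ρ M (N ∷ Ns) = rename-apps ρ (app M N) Ns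

apps-++ : ∀ M As Bs → apps (apps M As) Bs ≡ apps M (As ++ Bs)
apps-++ M As Bs = sym (foldl-++ app M As Bs)

ValueSubst : (ℕ → Term) → Set
ValueSubst σ = ∀ n → IsValue (σ n)

rename-value : ∀ ρ {V} → IsValue V → IsValue (rename ρ V)
rename-value ρ (var n) = var _
rename-value ρ (lam M) = lam _

subst-value : ∀ {σ} → ValueSubst σ → ∀ {V} → IsValue V → IsValue (subst σ V)
subst-value h (var n) = h n
subst-value h (lam M) = lam _

exts-value : ∀ {σ} → ValueSubst σ → ValueSubst (exts σ)
exts-value h zero    = var zero
exts-value h (suc n) = rename-value suc (h n)

⇒-rename : ∀ ρ {M M'} → M ⇒ M' → rename ρ M ⇒ rename ρ M'
⇒s-rename : ∀ ρ {Ms Ms'} → Pointwise _⇒_ Ms Ms' →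
            Pointwise _⇒_ (map (rename ρ) Ms) (map (rename ρ) Ms')
⇒-rename ρ (β {M₀} {M₀'} {V} {V'} {Ms} {Ms'} v v' p q ps) =
  retype _⇒_ (rename-apps ρ (app (lam M₀) V) Ms)
         (trans (rename-apps ρ (M₀' [ V' ]) Ms')
                (≡-cong (λ X → apps X (map (rename ρ) Ms')) (rename-[] ρ M₀' V')))
         (β (rename-value ρ v) (rename-value ρ v') (⇒-rename ρ p) (⇒-rename (ext ρ) q) (⇒s-rename ρ ps))
⇒-rename ρ (σ₁ {M₀} {M₀'} {N} {N'} {L} {L'} {Ms} {Ms'} n l m ps) =
  retype _⇒_ (rename-apps ρ (app (app (lam M₀) N) L) Ms)
         (trans (rename-apps ρ (app (lam (app M₀' (shift L'))) N') Ms')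
                (≡-cong (λ X → apps (app (lam (app (rename (ext ρ) M₀') X)) (rename ρ N')) (map (rename ρ) Ms'))
                        (rename-shift ρ L')))
         (σ₁ (⇒-rename ρ n) (⇒-rename ρ l) (⇒-rename (ext ρ) m) (⇒s-rename ρ ps))
⇒-rename ρ (σ₃ {V} {V'} {N} {N'} {L} {L'} {Ms} {Ms'} v v' pv n l ps) =
  retype _⇒_ (rename-apps ρ (app V (app (lam L) N)) Ms)
         (trans (rename-apps ρ (app (lam (app (shift V') L')) N') Ms')
                (≡-cong (λ X → apps (app (lam (app X (rename (ext ρ) L'))) (rename ρ N')) (map (rename ρ) Ms'))
                        (rename-shift ρ V')))
         (σ₃ (rename-value ρ v) (rename-value ρ v') (⇒-rename ρ pv) (⇒-rename ρ n)
             (⇒-rename (ext ρ) l) (⇒s-rename ρ ps))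
⇒-rename ρ (lam {M₀} {M₀'} {Ms} {Ms'} p ps) =
  retype _⇒_ (rename-apps ρ (lam M₀) Ms) (rename-apps ρ (lam M₀') Ms')
         (lam (⇒-rename (ext ρ) p) (⇒s-rename ρ ps))
⇒-rename ρ (var {x} {Ms} {Ms'} ps) =
  retype _⇒_ (rename-apps ρ (var x) Ms) (rename-apps ρ (var x) Ms') (var (⇒s-rename ρ ps))
⇒s-rename ρ []       = []
⇒s-rename ρ (p ∷ ps) = ⇒-rename ρ p ∷ ⇒s-rename ρ ps

-- Parallel reduction is compatible with extending both sides by a spine
-- of parallel reductions: every rule already carries an arbitrary spine.
⇒-apps : ∀ {A A' Ns Ns'} → A ⇒ A' → Pointwise _⇒_ Ns Ns' → apps A Ns ⇒ apps A' Ns'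
⇒-apps {Ns = Ns} {Ns'} (β {M₀} {M₀'} {V} {V'} {Ms} {Ms'} v v' p q ps) qs =
  retype _⇒_ (apps-++ (app (lam M₀) V) Ms Ns) (apps-++ (M₀' [ V' ]) Ms' Ns')
         (β v v' p q (Pointwise-++⁺ ps qs))
⇒-apps {Ns = Ns} {Ns'} (σ₁ {M₀} {M₀'} {N} {N'} {L} {L'} {Ms} {Ms'} n l m ps) qs =
  retype _⇒_ (apps-++ (app (app (lam M₀) N) L) Ms Ns) (apps-++ (app (lam (app M₀' (shift L'))) N') Ms' Ns')
         (σ₁ n l m (Pointwise-++⁺ ps qs))
⇒-apps {Ns = Ns} {Ns'} (σ₃ {V} {V'} {N} {N'} {L} {L'} {Ms} {Ms'} v v' pv n l ps) qs =
  retype _⇒_ (apps-++ (app V (app (lam L) N)) Ms Ns) (apps-++ (app (lam (app (shift V') L')) N') Ms' Ns')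
         (σ₃ v v' pv n l (Pointwise-++⁺ ps qs))
⇒-apps {Ns = Ns} {Ns'} (lam {M₀} {M₀'} {Ms} {Ms'} p ps) qs =
  retype _⇒_ (apps-++ (lam M₀) Ms Ns) (apps-++ (lam M₀') Ms' Ns') (lam p (Pointwise-++⁺ ps qs))
⇒-apps {Ns = Ns} {Ns'} (var {x} {Ms} {Ms'} ps) qs =
  retype _⇒_ (apps-++ (var x) Ms Ns) (apps-++ (var x) Ms' Ns') (var (Pointwise-++⁺ ps qs))

record _⇒ₛ_ (σ τ : ℕ → Term) : Set where
  field
    reduces    : ∀ n → σ n ⇒ τ n
    src-values : ValueSubst σ
    tgt-values : ValueSubst τ
open _⇒ₛ_

exts-⇒ₛ : ∀ {σ τ} → σ ⇒ₛ τ → exts σ ⇒ₛ exts τ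
reduces    (exts-⇒ₛ h) zero    = var []
reduces    (exts-⇒ₛ h) (suc n) = ⇒-rename suc (reduces h n)
src-values (exts-⇒ₛ h)         = exts-value (src-values h)
tgt-values (exts-⇒ₛ h)         = exts-value (tgt-values h)

⇒-subst : ∀ {σ τ} → σ ⇒ₛ τ → ∀ {M M'} → M ⇒ M' → subst σ M ⇒ subst τ M'
⇒s-subst : ∀ {σ τ} → σ ⇒ₛ τ → ∀ {Ms Ms'} → Pointwise _⇒_ Ms Ms' →
           Pointwise _⇒_ (map (subst σ) Ms) (map (subst τ) Ms')
⇒-subst {σ} {τ} h (β {M₀} {M₀'} {V} {V'} {Ms} {Ms'} v v' p q ps) =
  retype _⇒_ (subst-apps σ (app (lam M₀) V) Ms)
         (trans (subst-apps τ (M₀' [ V' ]) Ms')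
                (≡-cong (λ X → apps X (map (subst τ) Ms')) (subst-[] τ M₀' V')))
         (β (subst-value (src-values h) v) (subst-value (tgt-values h) v')
            (⇒-subst h p) (⇒-subst (exts-⇒ₛ h) q) (⇒s-subst h ps))
⇒-subst {σ} {τ} h (σ₁ {M₀} {M₀'} {N} {N'} {L} {L'} {Ms} {Ms'} n l m ps) =
  retype _⇒_ (subst-apps σ (app (app (lam M₀) N) L) Ms)
         (trans (subst-apps τ (app (lam (app M₀' (shift L'))) N') Ms')
                (≡-cong (λ X → apps (app (lam (app (subst (exts τ) M₀') X)) (subst τ N')) (map (subst τ) Ms'))
                        (subst-shift τ L')))
         (σ₁ (⇒-subst h n) (⇒-subst h l) (⇒-subst (exts-⇒ₛ h) m) (⇒s-subst h ps))
⇒-subst {σ} {τ} h (σ₃ {V} {V'} {N} {N'} {L} {L'} {Ms} {Ms'} v v' pv n l ps) =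
  retype _⇒_ (subst-apps σ (app V (app (lam L) N)) Ms)
         (trans (subst-apps τ (app (lam (app (shift V') L')) N') Ms')
                (≡-cong (λ X → apps (app (lam (app X (subst (exts τ) L'))) (subst τ N')) (map (subst τ) Ms'))
                        (subst-shift τ V')))
         (σ₃ (subst-value (src-values h) v) (subst-value (tgt-values h) v') (⇒-subst h pv)
             (⇒-subst h n) (⇒-subst (exts-⇒ₛ h) l) (⇒s-subst h ps))
⇒-subst {σ} {τ} h (lam {M₀} {M₀'} {Ms} {Ms'} p ps) =
  retype _⇒_ (subst-apps σ (lam M₀) Ms) (subst-apps τ (lam M₀') Ms')
         (lam (⇒-subst (exts-⇒ₛ h) p) (⇒s-subst h ps))
⇒-subst {σ} {τ} h (var {x} {Ms} {Ms'} ps) =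
  retype _⇒_ (subst-apps σ (var x) Ms) (subst-apps τ (var x) Ms')
         (⇒-apps (reduces h x) (⇒s-subst h ps))
⇒s-subst h []       = []
⇒s-subst h (p ∷ ps) = ⇒-subst h p ∷ ⇒s-subst h ps

→hβv-subst : ∀ σ → ValueSubst σ → ∀ {X Y} → X →hβv Y → subst σ X →hβv subst σ Y
→hβv-subst σ hv (β {M} {V} Ms v) =
  retype _→hβv_ (subst-apps σ (app (lam M) V) Ms)
         (trans (subst-apps σ (M [ V ]) Ms) (≡-cong (λ Z → apps Z (map (subst σ) Ms)) (subst-[] σ M V)))
         (β (map (subst σ) Ms) (subst-value hv v))
→hβv-subst σ hv (cong {V} {N} {N'} Ms v s) =
  retype _→hβv_ (subst-apps σ (app V N) Ms) (subst-apps σ (app V N') Ms)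
         (cong (map (subst σ) Ms) (subst-value hv v) (→hβv-subst σ hv s))

→hσ-subst : ∀ σ → ValueSubst σ → ∀ {X Y} → X →hσ Y → subst σ X →hσ subst σ Y
→hσ-subst σ hv (σ₁ {M} {N} {L} Ms) =
  retype _→hσ_ (subst-apps σ (app (app (lam M) N) L) Ms)
         (trans (subst-apps σ (app (lam (app M (shift L))) N) Ms)
                (≡-cong (λ X → apps (app (lam (app (subst (exts σ) M) X)) (subst σ N)) (map (subst σ) Ms))
                        (subst-shift σ L)))
         (σ₁ (map (subst σ) Ms))
→hσ-subst σ hv (σ₃ {V} {L} {N} Ms v) =
  retype _→hσ_ (subst-apps σ (app V (app (lam L) N)) Ms)
         (trans (subst-apps σ (app (lam (app (shift V) L)) N) Ms)
                (≡-cong (λ X → apps (app (lam (app X (subst (exts σ) L))) (subst σ N)) (map (subst σ) Ms))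
                        (subst-shift σ V)))
         (σ₃ (map (subst σ) Ms) (subst-value hv v))
→hσ-subst σ hv (cong {V} {N} {N'} Ms v s) =
  retype _→hσ_ (subst-apps σ (app V N) Ms) (subst-apps σ (app V N') Ms)
         (cong (map (subst σ) Ms) (subst-value hv v) (→hσ-subst σ hv s))

⇒int-subst : ∀ {σ τ} → σ ⇒ₛ τ → (∀ n → σ n ⇒int τ n) →
             ∀ {M M'} → M ⇒int M' → subst σ M ⇒int subst τ M'
⇒int-subst h hi (lam p) = lam (⇒-subst (exts-⇒ₛ h) p)
⇒int-subst h hi (var x) = hi x
⇒int-subst {σ} {τ} h hi (app {V} {V'} {N} {N'} {Ms} {Ms'} v v' p i ps) =
  retype _⇒int_ (subst-apps σ (app V N) Ms) (subst-apps τ (app V' N') Ms')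
         (app (subst-value (src-values h) v) (subst-value (tgt-values h) v')
              (⇒-subst h p) (⇒int-subst h hi i) (⇒s-subst h ps))

→hβv-apps : ∀ Ns {X Y} → X →hβv Y → apps X Ns →hβv apps Y Ns
→hβv-apps Ns (β {M} {V} Ms v) =
  retype _→hβv_ (apps-++ (app (lam M) V) Ms Ns) (apps-++ (M [ V ]) Ms Ns) (β (Ms ++ Ns) v)
→hβv-apps Ns (cong {V} {N} {N'} Ms v s) =
  retype _→hβv_ (apps-++ (app V N) Ms Ns) (apps-++ (app V N') Ms Ns) (cong (Ms ++ Ns) v s)

→hσ-apps : ∀ Ns {X Y} → X →hσ Y → apps X Ns →hσ apps Y Ns
→hσ-apps Ns (σ₁ {M} {N} {L} Ms) =
  retype _→hσ_ (apps-++ (app (app (lam M) N) L) Ms Ns) (apps-++ (app (lam (app M (shift L))) N) Ms Ns)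
         (σ₁ (Ms ++ Ns))
→hσ-apps Ns (σ₃ {V} {L} {N} Ms v) =
  retype _→hσ_ (apps-++ (app V (app (lam L) N)) Ms Ns) (apps-++ (app (lam (app (shift V) L)) N) Ms Ns)
         (σ₃ (Ms ++ Ns) v)
→hσ-apps Ns (cong {V} {N} {N'} Ms v s) =
  retype _→hσ_ (apps-++ (app V N) Ms Ns) (apps-++ (app V N') Ms Ns) (cong (Ms ++ Ns) v s)

→hβv*-arg : ∀ {V N N'} Ms → IsValue V → Star _→hβv_ N N' →
            Star _→hβv_ (apps (app V N) Ms) (apps (app V N') Ms)
→hβv*-arg {V} Ms v = gmap (λ X → apps (app V X) Ms) (cong Ms v)

→hσ*-arg : ∀ {V N N'} Ms → IsValue V → Star _→hσ_ N N' →
           Star _→hσ_ (apps (app V N) Ms) (apps (app V N') Ms)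
→hσ*-arg {V} Ms v = gmap (λ X → apps (app V X) Ms) (cong Ms v)

IsApp : Term → Set
IsApp (app _ _) = ⊤
IsApp (var _)   = ⊥
IsApp (lam _)   = ⊥

apps-IsApp : ∀ A B Ms → IsApp (apps (app A B) Ms)
apps-IsApp A B []       = tt
apps-IsApp A B (N ∷ Ns) = apps-IsApp (app A B) N Ns

value-¬IsApp : ∀ {V} → IsValue V → IsApp V → ⊥
value-¬IsApp (var n) ()
value-¬IsApp (lam M) ()

→hβv-source : ∀ {X Y} → X →hβv Y → IsApp X
→hβv-source (β Ms v)      = apps-IsApp _ _ Ms
→hβv-source (cong Ms v s) = apps-IsApp _ _ Ms

→hσ-source : ∀ {X Y} → X →hσ Y → IsApp X
→hσ-source (σ₁ Ms)       = apps-IsApp _ _ Ms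
→hσ-source (σ₃ Ms v)     = apps-IsApp _ _ Ms
→hσ-source (cong Ms v s) = apps-IsApp _ _ Ms

→hσ-target : ∀ {X Y} → X →hσ Y → IsApp Y
→hσ-target (σ₁ Ms)       = apps-IsApp _ _ Ms
→hσ-target (σ₃ Ms v)     = apps-IsApp _ _ Ms
→hσ-target (cong Ms v s) = apps-IsApp _ _ Ms

-- Since σ-steps produce applications, a σ-sequence ending in a value is
-- empty.
→hσ*-to-value : ∀ {P Q} → Star _→hσ_ P Q → IsValue Q → P ≡ Q
→hσ*-to-value ε       v = refl
→hσ*-to-value (s ◅ r) v with →hσ*-to-value r v
... | refl = ⊥-elim (value-¬IsApp v (→hσ-target s))

-- The factorisation: head β_v-steps, then head σ-steps, then an internal
-- parallel step.  M ⇛ N is exactly M ⇒ N together with M ▷ N.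
_▷_ : Term → Term → Set
M ▷ N = ∃₂ λ M' M'' → Star _→hβv_ M M' × Star _→hσ_ M' M'' × (M'' ⇒int N)

-- A value admits no head step, so its factorisations are internal steps.
▷-value : ∀ {V V'} → IsValue V → V ▷ V' → V ⇒int V'
▷-value v (_ , _ , ε     , ε     , i) = i
▷-value v (_ , _ , s ◅ _ , _     , _) = ⊥-elim (value-¬IsApp v (→hβv-source s))
▷-value v (_ , _ , ε     , s ◅ _ , _) = ⊥-elim (value-¬IsApp v (→hσ-source s))

→hβv*-▷ : ∀ {X Y Z} → Star _→hβv_ X Y → Y ▷ Z → X ▷ Z
→hβv*-▷ r (P , Q , s₁ , s₂ , i) = P , Q , r ◅◅ s₁ , s₂ , i

-- A value W ⇒int W' applied to arguments that reduce (and factorise)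
-- pointwise: the head steps of the first argument become head steps of the
-- whole term, the rest is internal.
▷-value-apps : ∀ {W W' Ns Ns'} → IsValue W → IsValue W' → W ⇒ W' → W ⇒int W' →
               Pointwise _⇒_ Ns Ns' → Pointwise _▷_ Ns Ns' → apps W Ns ▷ apps W' Ns'
▷-value-apps {W} v v' p i [] [] = W , W , ε , ε , i
▷-value-apps {W} {Ns = N ∷ Ns} v v' p i (_ ∷ ps) ((P , Q , s₁ , s₂ , j) ∷ _) =
  apps (app W P) Ns , apps (app W Q) Ns ,
  →hβv*-arg Ns v s₁ , →hσ*-arg Ns v s₂ , app v v' p j ps

-- If the
-- internal step is at an application the spine is simply appended; if it
-- is at a value, no σ-step occurred and the previous lemma applies.
▷-apps : ∀ {M M' Ns Ns'} → M ▷ M' → Pointwise _⇒_ Ns Ns' → Pointwise _▷_ Ns Ns' →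
         apps M Ns ▷ apps M' Ns'
▷-apps {Ns = Ns} (P , Q , s₁ , s₂ , lam p) ps hs with →hσ*-to-value s₂ (lam _)
... | refl = →hβv*-▷ (gmap _ (→hβv-apps Ns) s₁) (▷-value-apps (lam _) (lam _) (lam p []) (lam p) ps hs)
▷-apps {Ns = Ns} (P , Q , s₁ , s₂ , var x) ps hs with →hσ*-to-value s₂ (var x)
... | refl = →hβv*-▷ (gmap _ (→hβv-apps Ns) s₁) (▷-value-apps (var x) (var x) (var []) (var x) ps hs)
▷-apps {Ns = Ns} {Ns'} (P , Q , s₁ , s₂ , app {V} {V'} {N} {N'} {Ms} {Ms'} v v' p i qs) ps hs =
  apps P Ns , apps Q Ns , gmap _ (→hβv-apps Ns) s₁ , gmap _ (→hσ-apps Ns) s₂ ,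
  retype _⇒int_ (apps-++ (app V N) Ms Ns) (apps-++ (app V' N') Ms' Ns') (app v v' p i (Pointwise-++⁺ qs ps))

-- Factorisations are stable under instantiating a binder with a value
-- V ⇒int V': the head steps are substituted with V, the internal step
-- in parallel with V ⇒ V'.
▷-[] : ∀ {M M' V V'} → M ▷ M' → IsValue V → IsValue V' → V ⇒ V' → V ⇒int V' →
       (M [ V ]) ▷ (M' [ V' ])
▷-[] {V = V} {V'} (P , Q , s₁ , s₂ , i) v v' p j =
  P [ V ] , Q [ V ] ,
  gmap _ (→hβv-subst (single V) (src-values single-⇒ₛ)) s₁ ,
  gmap _ (→hσ-subst (single V) (src-values single-⇒ₛ)) s₂ ,
  ⇒int-subst single-⇒ₛ single-⇒int i
  where
  single-⇒ₛ : single V ⇒ₛ single V'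
  reduces    single-⇒ₛ zero    = p
  reduces    single-⇒ₛ (suc n) = var []
  src-values single-⇒ₛ zero    = v
  src-values single-⇒ₛ (suc n) = var n
  tgt-values single-⇒ₛ zero    = v'
  tgt-values single-⇒ₛ (suc n) = var n
  single-⇒int : ∀ n → single V n ⇒int single V' n
  single-⇒int zero    = j
  single-⇒int (suc n) = var n

⇒-▷ : ∀ {M M'} → M ⇒ M' → M ▷ M'
⇒s-▷ : ∀ {Ms Ms'} → Pointwise _⇒_ Ms Ms' → Pointwise _▷_ Ms Ms'
-- (λx.M₀)V Ms: fire the redex, then substitute into the body's factorisation.
⇒-▷ (β {Ms = Ms} v v' p q ps) =
  →hβv*-▷ (β Ms v ◅ ε) (▷-apps (▷-[] (⇒-▷ q) v v' p (▷-value v (⇒-▷ p))) ps (⇒s-▷ ps))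
-- (λx.M₀)N L Ms: head-reduce N in place, fire σ₁, then σ-reduce N under
-- the new head; the rest is internal.
⇒-▷ (σ₁ {M₀} {L = L} {Ms = Ms} n l m ps) with ⇒-▷ n
... | P , Q , s₁ , s₂ , i =
  apps (app (lam M₀) P) (L ∷ Ms) , apps (app (lam (app M₀ (shift L))) Q) Ms ,
  →hβv*-arg (L ∷ Ms) (lam M₀) s₁ , σ₁ Ms ◅ →hσ*-arg Ms (lam _) s₂ ,
  app (lam _) (lam _) (lam (⇒-apps m (⇒-rename suc l ∷ [])) []) i ps
-- V((λx.L)N) Ms: head-reduce N inside the argument, fire σ₃, and continue
-- as for σ₁.
⇒-▷ (σ₃ {V} {L = L} {Ms = Ms} v v' pv n l ps) with ⇒-▷ n
... | P , Q , s₁ , s₂ , i =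
  apps (app V (app (lam L) P)) Ms , apps (app (lam (app (shift V) L)) Q) Ms ,
  gmap (λ X → apps (app V (app (lam L) X)) Ms) (λ s → cong Ms v (cong [] (lam L) s)) s₁ ,
  σ₃ Ms v ◅ →hσ*-arg Ms (lam _) s₂ ,
  app (lam _) (lam _) (lam (⇒-apps (⇒-rename suc pv) (l ∷ [])) []) i ps
⇒-▷ (lam p ps) = ▷-value-apps (lam _) (lam _) (lam p []) (lam p) ps (⇒s-▷ ps)
⇒-▷ (var ps)   = ▷-value-apps (var _) (var _) (var []) (var _) ps (⇒s-▷ ps)
⇒s-▷ []       = []
⇒s-▷ (p ∷ ps) = ⇒-▷ p ∷ ⇒s-▷ ps

lemma3p16 : ∀ {M M'} → M ⇒ M' → M ⇛ M'
lemma3p16 p = p , ⇒-▷ p
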